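{- Let $\Gamma$ be a finite connected graph and $G\leqslant\mathrm{Aut}(\Gamma)$ such that $G$ is transitive on the vertices of $\Gamma$ and quasiprimitive on the edges of $\Gamma$. Then $G$ is either quasiprimitive or biquasiprimitive on the vertex set of $\Gamma$.
   Context: A transitive permutation group is quasiprimitive if every nontrivial normal subgroup is transitive; it is biquasiprimitive if it is not quasiprimitive and every normal subgroup has at most two orbits. -}

module Defs where

open import Data.Nat using (ℕ)
open import Data.Fin using (Fin)
open import Data.Fin.Subset using (Subset; _∈_; ⊤)
open import Data.Bool using (Bool; true; false; T)
open import Data.Product using (Σ; ∃; _×_; _,_)
open import Data.Sum using (_⊎_)
open import Relation.Nullary using (¬_)
open import Relation.Binary.PropositionalEquality using (_≡_; _≢_)
open import Relation.Binary.Construct.Closure.ReflexiveTransitive using (Star)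
open import Function.Definitions using (Bijective)

record Graph (n : ℕ) : Set where
  field
    adj   : Fin n → Fin n → Bool
    sym   : ∀ u v → adj u v ≡ adj v u
    irrefl : ∀ u → adj u u ≡ false

open Graph public

Adj : ∀ {n} → Graph n → Fin n → Fin n → Set
Adj Γ u v = T (adj Γ u v)

Connected : ∀ {n} → Graph n → Set
Connected {n} Γ = ∀ (u v : Fin n) → Star (Adj Γ) u v

-- A finite permutation group of degree n, given by an enumeration
-- elt : Fin k → Sym(Fin n) of its elements (repetitions allowed),
-- closed under identity, composition and inverses.
record PermGroup (n : ℕ) : Set where
  field
    k        : ℕ
    elt      : Fin k → Fin n → Fin n
    bij      : ∀ i → Bijective _≡_ _≡_ (elt i)
    id-mem   : ∃ λ i → ∀ x → elt i x ≡ x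
    ∘-mem    : ∀ i j → ∃ λ l → ∀ x → elt l x ≡ elt i (elt j x)
    inv-mem  : ∀ i → ∃ λ j → ∀ x → elt j (elt i x) ≡ x

open PermGroup public

IsAutGroup : ∀ {n} → Graph n → PermGroup n → Set
IsAutGroup Γ G = ∀ i u v → adj Γ (elt G i u) (elt G i v) ≡ adj Γ u v

-- Subgroups of G are described by the set N ⊆ Fin k of indices of their
-- elements; the subgroup is { elt G i | i ∈ N }.
IsNormalSubgroup : ∀ {n} (G : PermGroup n) → Subset (k G) → Set
IsNormalSubgroup G N =
  (∃ λ i → i ∈ N × (∀ x → elt G i x ≡ x)) ×
  (∀ i j → i ∈ N → j ∈ N →
     ∃ λ l → l ∈ N × (∀ x → elt G l x ≡ elt G i (elt G j x))) ×
  (∀ i → i ∈ N → ∃ λ j → j ∈ N × (∀ x → elt G j (elt G i x) ≡ x)) ×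
  -- normality: for g ∈ G, h ∈ N, g h g⁻¹ ∈ N, i.e. ∃ l ∈ N with l ∘ g = g ∘ h
  (∀ g i → i ∈ N →
     ∃ λ l → l ∈ N × (∀ x → elt G l (elt G g x) ≡ elt G g (elt G i x)))

Nontrivial : ∀ {n} (G : PermGroup n) → Subset (k G) → Set
Nontrivial G N = ∃ λ i → i ∈ N × ∃ λ x → elt G i x ≢ x

VTransitive : ∀ {n} (G : PermGroup n) → Subset (k G) → Set
VTransitive {n} G H =
  Fin n × (∀ u v → ∃ λ i → i ∈ H × elt G i u ≡ v)

AtMostTwoOrbits : ∀ {n} (G : PermGroup n) → Subset (k G) → Set
AtMostTwoOrbits {n} G H =
  Σ (Fin n) λ a → Σ (Fin n) λ b → ∀ v →
    (∃ λ i → i ∈ H × elt G i a ≡ v) ⊎ (∃ λ i → i ∈ H × elt G i b ≡ v)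

VQuasiprimitive : ∀ {n} → PermGroup n → Set
VQuasiprimitive G =
  VTransitive G ⊤ ×
  (∀ N → IsNormalSubgroup G N → Nontrivial G N → VTransitive G N)

VBiquasiprimitive : ∀ {n} → PermGroup n → Set
VBiquasiprimitive G =
  VTransitive G ⊤ × ¬ VQuasiprimitive G ×
  (∀ N → IsNormalSubgroup G N → Nontrivial G N → AtMostTwoOrbits G N)

-- Action on edges.  An edge {u,v} is represented by an ordered pair
-- (u , v) with u adjacent to v; (u,v) and (v,u) are the same edge.

SameEdge : ∀ {n} → Fin n → Fin n → Fin n → Fin n → Set
SameEdge u v u' v' = (u ≡ u' × v ≡ v') ⊎ (u ≡ v' × v ≡ u')

ETransitive : ∀ {n} (Γ : Graph n) (G : PermGroup n) → Subset (k G) → Set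
ETransitive {n} Γ G H =
  (Σ (Fin n) λ u → Σ (Fin n) λ v → Adj Γ u v) ×
  (∀ u v u' v' → Adj Γ u v → Adj Γ u' v' →
     ∃ λ i → i ∈ H × SameEdge (elt G i u) (elt G i v) u' v')

EQuasiprimitive : ∀ {n} → Graph n → PermGroup n → Set
EQuasiprimitive Γ G =
  ETransitive Γ G ⊤ ×
  (∀ N → IsNormalSubgroup G N → Nontrivial G N → ETransitive Γ G N)

module Submission where

-- Every property of G in sight is a finite,
-- decidable property, so either every nontrivial normal subgroup of G is
-- vertex-transitive (and G is vertex-quasiprimitive), or some nontrivial
-- normal subgroup N₀ is not (and G is not vertex-quasiprimitive).  In the
-- second case G is vertex-biquasiprimitive: a nontrivial normal subgroup N
-- is edge-transitive by edge-quasiprimitivity, and an edge-transitive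
-- subgroup of a connected graph has at most two vertex orbits, namely those
-- of the two ends a, b of any edge — every vertex v ≠ a lies on some edge,
-- which N maps from {a , b}, so v is in the N-orbit of a or of b.

open import Defs
open import Data.Nat using (ℕ; zero; suc)
open import Data.Sum using (_⊎_; inj₁; inj₂)
open import Data.Fin using (Fin)
open import Data.Fin.Subset using (Subset; _∈_; ⊤)
open import Data.Fin.Subset.Properties using (_∈?_; anySubset?)
open import Data.Fin.Properties using (any?; all?) renaming (_≟_ to _≟F_)
open import Data.Product using (∃; _×_; _,_)
open import Data.Empty using (⊥-elim)
open import Relation.Nullary using (¬_; Dec; yes; no)
open import Relation.Nullary.Decidable.Core using (_×-dec_; _→-dec_; ¬?)
open import Relation.Binary.PropositionalEquality using (_≡_; refl)
open import Relation.Binary.Construct.Closure.ReflexiveTransitive using (ε; _◅_)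

nonEmpty? : ∀ n → Dec (Fin n)
nonEmpty? zero    = no (λ ())
nonEmpty? (suc n) = yes Fin.zero

module Decidability {n : ℕ} (G : PermGroup n) where

  maps? : ∀ (i : Fin (k G)) x y → Dec (elt G i x ≡ y)
  maps? i x y = elt G i x ≟F y

  normal? : ∀ N → Dec (IsNormalSubgroup G N)
  normal? N =
    any? (λ i → (i ∈? N) ×-dec all? (λ x → maps? i x x)) ×-dec
    all? (λ i → all? (λ j → (i ∈? N) →-dec ((j ∈? N) →-dec
       any? (λ l → (l ∈? N) ×-dec all? (λ x → maps? l x (elt G i (elt G j x))))))) ×-dec
    all? (λ i → (i ∈? N) →-dec
       any? (λ j → (j ∈? N) ×-dec all? (λ x → maps? j (elt G i x) x))) ×-dec
    all? (λ g → all? (λ i → (i ∈? N) →-dec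
       any? (λ l → (l ∈? N) ×-dec all? (λ x → maps? l (elt G g x) (elt G g (elt G i x))))))

  nontrivial? : ∀ N → Dec (Nontrivial G N)
  nontrivial? N = any? (λ i → (i ∈? N) ×-dec any? (λ x → ¬? (maps? i x x)))

  vTransitive? : ∀ N → Dec (VTransitive G N)
  vTransitive? N =
    nonEmpty? n ×-dec all? (λ u → all? (λ v → any? (λ i → (i ∈? N) ×-dec maps? i u v)))

IntransitiveNormal : ∀ {n} → PermGroup n → Set
IntransitiveNormal G =
  ∃ λ N → IsNormalSubgroup G N × Nontrivial G N × ¬ VTransitive G N

intransitiveNormal? : ∀ {n} (G : PermGroup n) → Dec (IntransitiveNormal G)
intransitiveNormal? G =
  anySubset? (λ N → normal? N ×-dec nontrivial? N ×-dec ¬? (vTransitive? N))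
  where open Decidability G

quasiprimitive-or-obstruction : ∀ {n} (G : PermGroup n) → VTransitive G ⊤ →
  VQuasiprimitive G ⊎ IntransitiveNormal G
quasiprimitive-or-obstruction G vt with intransitiveNormal? G
... | yes obstruction  = inj₂ obstruction
... | no noObstruction = inj₁ (vt , transitive)
  where
  transitive : ∀ N → IsNormalSubgroup G N → Nontrivial G N → VTransitive G N
  transitive N normal nontriv with Decidability.vTransitive? G N
  ... | yes t = t
  ... | no ¬t = ⊥-elim (noObstruction (N , normal , nontriv , ¬t))

obstruction⇒¬quasiprimitive : ∀ {n} {G : PermGroup n} →
  IntransitiveNormal G → ¬ VQuasiprimitive G
obstruction⇒¬quasiprimitive (N , normal , nontriv , ¬t) (_ , qp) = ¬t (qp N normal nontriv)

equal-or-onEdge : ∀ {n} {Γ : Graph n} → Connected Γ →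
  ∀ a v → v ≡ a ⊎ ∃ λ w → Adj Γ v w
equal-or-onEdge conn a v with conn v a
... | ε                   = inj₁ refl
... | _◅_ {j = w} vw _    = inj₂ (w , vw)

edgeTransitive⇒atMostTwoOrbits : ∀ {n} (Γ : Graph n) (G : PermGroup n) (H : Subset (k G)) →
  Connected Γ → (∃ λ i → i ∈ H × (∀ x → elt G i x ≡ x)) →
  ETransitive Γ G H → AtMostTwoOrbits G H
edgeTransitive⇒atMostTwoOrbits Γ G H conn (e , e∈H , e-id) ((a , b , ab) , etrans) =
  a , b , orbitOf
  where
  orbitOf : ∀ v → (∃ λ i → i ∈ H × elt G i a ≡ v) ⊎ (∃ λ i → i ∈ H × elt G i b ≡ v)
  orbitOf v with equal-or-onEdge {Γ = Γ} conn a v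
  ... | inj₁ refl = inj₁ (e , e∈H , e-id a)
  ... | inj₂ (w , vw) with etrans a b v w ab vw
  ...   | i , i∈H , inj₁ (ia≡v , _) = inj₁ (i , i∈H , ia≡v)
  ...   | i , i∈H , inj₂ (_ , ib≡v) = inj₂ (i , i∈H , ib≡v)

lemma3p5 : (n : ℕ) (Γ : Graph n) (G : PermGroup n) →
    Connected Γ → IsAutGroup Γ G →
    VTransitive G ⊤ → EQuasiprimitive Γ G →
    VQuasiprimitive G ⊎ VBiquasiprimitive G
lemma3p5 n Γ G conn _ vt (_ , edgeQuasiprimitive)
  with quasiprimitive-or-obstruction G vt
... | inj₁ qp          = inj₁ qp
... | inj₂ obstruction =
  inj₂ (vt , obstruction⇒¬quasiprimitive {G = G} obstruction , twoOrbits)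
  where
  twoOrbits : ∀ N → IsNormalSubgroup G N → Nontrivial G N → AtMostTwoOrbits G N
  twoOrbits N normal@(hasIdentity , _) nontriv =
    edgeTransitive⇒atMostTwoOrbits Γ G N conn hasIdentity
      (edgeQuasiprimitive N normal nontriv)
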